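{- The orthodontic sort order $\le_{\mathrm{os}}$ is a partial order on $S_n$, and the identity permutation is its minimum element.
   Context: $[m,n]=\{m,\ldots,n\}$, $[0]=\emptyset$. $s_j$ adjacent transposition; permutations act on the right on positions ($ws_j$ is $w$ with $w(j),w(j+1)$ swapped). Rothe diagram $D(w)=\{(i,j)\in[n]^2: i<w^{ -1}(j),\ j<w(i)\}$, columns $D(w)_j=\{i:(i,j)\in D(w)\}$. Standard interval: $[j]$, $j\ge0$. Dominant: all columns of $D(w)$ are standard intervals. Missing tooth of column $C$: $i\ge1$, $i\notin C$, $i+1\in C$. Primary column data: if $w$ not dominant, $h$ minimal with $D(w)_{h+1}$ not a standard interval, $C=D(w)_{h+1}$, $\alpha$ maximal with $[\alpha]\subseteq C$, $i_1$ smallest missing tooth of $C$, $\beta=i_1-\alpha$; if dominant, $(h,C,\alpha,i_1,\beta)=(n,\emptyset,0,n,n)$. $w$ maps $[\alpha+1,i_1]$ onto $[h-\beta+1,h]$; $\sigma(w)\in S_\beta$, $\sigma(w)(p)=w(\alpha+p)-(h-\beta)$; $w$ is sorted if $\sigma(w)$ is the identity. $w_{\mathrm{sort}}$ is obtained from $w$ by reordering $w(\alpha+1),\ldots,w(i_1)$ increasingly. The orthodontic sort order $\le_{\mathrm{os}}$ is the reflexive and transitive closure of the relations $w_{\mathrm{sort}}\preccurlyeq w$ for all $w$, and $ws_{i_1}s_{i_1-1}\cdots s_{\alpha+1}\preccurlyeq w$ whenever $w$ is nonidentity and sorted (with $(h,C,\alpha,i_1,\beta)$ the primary column data of $w$).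 -}

module Defs where

open import Data.Nat using (ℕ; zero; suc; _+_; _∸_; _≤_; _<_; _≤ᵇ_; _≡ᵇ_)
open import Data.Bool using (if_then_else_)
open import Data.List using (List; []; _∷_; map; upTo; take; drop; _++_)
open import Data.Product using (_×_; ∃-syntax)
open import Data.Sum using (_⊎_)
open import Function.Bundles using (_⇔_)
open import Relation.Nullary using (¬_)
open import Relation.Binary.PropositionalEquality using (_≡_; _≢_)
open import Data.List.Relation.Binary.Permutation.Propositional using (_↭_)
open import Relation.Binary.Construct.Closure.ReflexiveTransitive using (Star)

-- Permutations of [n] = {1,…,n} in one-line notation: the list
-- [w(1), …, w(n)].

oneTo : ℕ → List ℕ
oneTo n = map suc (upTo n)

idPerm : ℕ → List ℕ
idPerm = oneTo

IsPerm : ℕ → List ℕ → Set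
IsPerm n w = w ↭ oneTo n

-- w(i) for 1-based position i (0 if out of range)
at : List ℕ → ℕ → ℕ
at []       _             = 0
at (x ∷ xs) zero          = 0
at (x ∷ xs) (suc zero)    = x
at (x ∷ xs) (suc (suc k)) = at xs (suc k)

-- w⁻¹(j): 1-based position of the value j in w (0 if absent)
pos : List ℕ → ℕ → ℕ
pos []       j = 0
pos (x ∷ xs) j = if x ≡ᵇ j then 1 else (if pos xs j ≡ᵇ 0 then 0 else suc (pos xs j))

InD : List ℕ → ℕ → ℕ → Set
InD w i j = (1 ≤ i) × (1 ≤ j) × (i < pos w j) × (j < at w i)

StdCol : List ℕ → ℕ → Set
StdCol w j = ∃[ k ] (∀ i → InD w i j ⇔ ((1 ≤ i) × (i ≤ k)))

Dominant : ℕ → List ℕ → Set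
Dominant n w = ∀ j → 1 ≤ j → j ≤ n → StdCol w j

MissingTooth : List ℕ → ℕ → ℕ → Set
MissingTooth w c i = (1 ≤ i) × (¬ InD w i c) × InD w (suc i) c

StdSubset : List ℕ → ℕ → ℕ → Set
StdSubset w c a = ∀ i → 1 ≤ i → i ≤ a → InD w i c

-- (h , α , i₁) is the primary column data of w ∈ S_n  (β = i₁ ∸ α, C = D(w)_{h+1})
Primary : ℕ → List ℕ → ℕ → ℕ → ℕ → Set
Primary n w h α i₁ =
    (Dominant n w × (h ≡ n) × (α ≡ 0) × (i₁ ≡ n))
  ⊎ ( (h < n)
    × (¬ StdCol w (suc h))
    × (∀ j → 1 ≤ j → j ≤ h → StdCol w j)
    × StdSubset w (suc h) α
    × (¬ StdSubset w (suc h) (suc α))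
    × MissingTooth w (suc h) i₁
    × (∀ i → MissingTooth w (suc h) i → i₁ ≤ i))

Sorted : List ℕ → ℕ → ℕ → ℕ → Set
Sorted w h α i₁ = ∀ p → 1 ≤ p → p ≤ (i₁ ∸ α) → (at w (α + p) ∸ (h ∸ (i₁ ∸ α))) ≡ p

insert : ℕ → List ℕ → List ℕ
insert x []       = x ∷ []
insert x (y ∷ ys) = if x ≤ᵇ y then x ∷ y ∷ ys else y ∷ insert x ys

isort : List ℕ → List ℕ
isort []       = []
isort (x ∷ xs) = insert x (isort xs)

sortWindow : ℕ → ℕ → List ℕ → List ℕ
sortWindow α i₁ w = take α w ++ isort (drop α (take i₁ w)) ++ drop i₁ w

-- w s_j : swap the entries in positions j and j+1 (1-based)
swapAt : ℕ → List ℕ → List ℕ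
swapAt (suc zero)    (x ∷ y ∷ r) = y ∷ x ∷ r
swapAt (suc (suc k)) (x ∷ r)     = x ∷ swapAt (suc k) r
swapAt _             w           = w

-- sDesc α c w = w s_{α+c} s_{α+c-1} ⋯ s_{α+1}
sDesc : ℕ → ℕ → List ℕ → List ℕ
sDesc α zero    w = w
sDesc α (suc c) w = sDesc α c (swapAt (α + suc c) w)

data Step (n : ℕ) : List ℕ → List ℕ → Set where
  sortStep  : ∀ {w h α i₁} → IsPerm n w → Primary n w h α i₁ →
              Step n (sortWindow α i₁ w) w
  cycleStep : ∀ {w h α i₁} → IsPerm n w → Primary n w h α i₁ →
              w ≢ idPerm n → Sorted w h α i₁ →
              Step n (sDesc α (i₁ ∸ α) w) w

_≤os[_]_ : List ℕ → ℕ → List ℕ → Set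
u ≤os[ n ] v = Star (Step n) u v

-- Every permutation w has unique primary column data (h, α, i₁), so w can be ranked
-- by (h, α, whether w is sorted) in lexicographic order. Each covering relation w′ ≼ w
-- with w′ ≠ w raises the rank. Sorting the window α+1, …, i₁ keeps the columns 1, …, h
-- of the diagram standard and column h+1 unchanged, so (h, α) stays and w′ is sorted.
-- On a sorted w the window holds the values h−β+1, …, h in order, and the cycle
-- s_{i₁} ⋯ s_{α+1} lifts w(i₁+1) > h+1 into row α+1 and turns the columns h−β+1, …, h
-- into [α+1]: columns 1, …, h stay standard and column h+1 now contains [α+1], so h or
-- else α increases. A rank that strictly increases along nontrivial steps makes ≤os
-- antisymmetric. Conversely every permutation other than the identity lies above some
-- step, and since the rank is bounded, descending from w reaches the identity.

module Submission where

open import Defs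
open import Data.Nat using (ℕ; zero; suc; _+_; _*_; _∸_; _≤_; _<_; _≤ᵇ_; _≡ᵇ_; z≤n; s≤s; _≟_; _≤?_; _<?_)
open import Data.Nat.Properties
open import Data.Bool using (true; false; T)
open import Data.List using (List; []; _∷_; _++_; take; drop; length)
open import Data.List.Properties using (length-take; length-drop; take-take; take++drop≡id; ++-assoc; map-upTo; ≡-dec)
open import Data.List.Membership.Propositional using (_∈_; _∉_)
open import Data.List.Relation.Unary.Any using (here; there)
open import Data.List.Relation.Unary.All as All using (All; []; _∷_)
open import Data.List.Relation.Unary.AllPairs as AllPairs using (AllPairs; []; _∷_)
open import Data.List.Relation.Unary.Unique.Propositional using (Unique)
import Data.List.Relation.Unary.Unique.Propositional.Properties as Unique
open import Data.List.Relation.Binary.Permutation.Propositional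
  using (_↭_; ↭-sym; ↭-trans; ↭⇒↭ₛ) renaming (refl to ↭-refl; prep to ↭-prep; swap to ↭-swap)
open import Data.List.Relation.Binary.Permutation.Propositional.Properties
  using (∈-resp-↭; All-resp-↭; ↭-length; ++⁺ˡ; ++⁺ʳ)
open import Data.List.Relation.Binary.Permutation.Setoid.Properties using (Unique-resp-↭)
open import Data.Product using (_×_; _,_; proj₁; proj₂; map₂; ∃-syntax)
open import Data.Sum using (_⊎_; inj₁; inj₂; [_,_]′)
open import Data.Empty using (⊥; ⊥-elim)
open import Data.Unit using (tt)
open import Function using (_∘_)
open import Function.Bundles using (_⇔_; mk⇔; Equivalence)
open import Relation.Nullary using (¬_; Dec; yes; no)
open import Relation.Nullary.Decidable using (_×-dec_; ¬?; decidable-stable; map′)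
open import Relation.Binary.Definitions using (tri<; tri≈; tri>)
open import Relation.Binary.PropositionalEquality
  using (_≡_; _≢_; refl; sym; trans; cong; cong₂; subst; subst₂; setoid; module ≡-Reasoning)
open import Relation.Binary.Construct.Closure.ReflexiveTransitive using (ε; _◅_; _◅◅_)

open Equivalence using (to; from)

nth : List ℕ → ℕ → ℕ
nth []       _       = 0
nth (x ∷ xs) zero    = x
nth (x ∷ xs) (suc i) = nth xs i

at-suc : ∀ w i → at w (suc i) ≡ nth w i
at-suc []       i       = refl
at-suc (x ∷ xs) zero    = refl
at-suc (x ∷ xs) (suc i) = at-suc xs i

at-zero : ∀ w → at w 0 ≡ 0
at-zero []       = refl
at-zero (x ∷ xs) = refl

nth-≥length : ∀ w i → length w ≤ i → nth w i ≡ 0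
nth-≥length []       i       _         = refl
nth-≥length (x ∷ xs) (suc i) (s≤s le) = nth-≥length xs i le

nth∈ : ∀ w i → i < length w → nth w i ∈ w
nth∈ (x ∷ xs) zero    _        = here refl
nth∈ (x ∷ xs) (suc i) (s≤s lt) = there (nth∈ xs i lt)

∈⇒nth : ∀ {v} w → v ∈ w → ∃[ i ] (i < length w × nth w i ≡ v)
∈⇒nth (x ∷ xs) (here refl) = 0 , s≤s z≤n , refl
∈⇒nth (x ∷ xs) (there v∈xs) with ∈⇒nth xs v∈xs
... | i , lt , e = suc i , s≤s lt , e

nth-ext : ∀ u w → length u ≡ length w → (∀ i → nth u i ≡ nth w i) → u ≡ w
nth-ext []       []       _  _ = refl
nth-ext (x ∷ xs) (y ∷ ys) eq f = cong₂ _∷_ (f 0) (nth-ext xs ys (suc-injective eq) (f ∘ suc))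

nth-++ˡ : ∀ xs ys i → i < length xs → nth (xs ++ ys) i ≡ nth xs i
nth-++ˡ (x ∷ xs) ys zero    _        = refl
nth-++ˡ (x ∷ xs) ys (suc i) (s≤s lt) = nth-++ˡ xs ys i lt

nth-++ʳ : ∀ xs ys i → nth (xs ++ ys) (length xs + i) ≡ nth ys i
nth-++ʳ []       ys i = refl
nth-++ʳ (x ∷ xs) ys i = nth-++ʳ xs ys i

nth-take : ∀ k w i → i < k → nth (take k w) i ≡ nth w i
nth-take (suc k) []      i       _        = refl
nth-take (suc k) (x ∷ w) zero    _        = refl
nth-take (suc k) (x ∷ w) (suc i) (s≤s lt) = nth-take k w i lt

nth-drop : ∀ k w i → nth (drop k w) i ≡ nth w (k + i)
nth-drop zero    w       i = refl
nth-drop (suc k) []      i = refl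
nth-drop (suc k) (x ∷ w) i = nth-drop k w i

length-take≤ : ∀ k (w : List ℕ) → k ≤ length w → length (take k w) ≡ k
length-take≤ k w le = trans (length-take k w) (m≤n⇒m⊓n≡m le)

take++slice++drop : ∀ a b (w : List ℕ) → a ≤ b → take a w ++ (drop a (take b w) ++ drop b w) ≡ w
take++slice++drop a b w a≤b = begin
  take a w ++ (drop a (take b w) ++ drop b w)
    ≡⟨ cong (_++ (drop a (take b w) ++ drop b w)) take-a-take-b ⟩
  take a (take b w) ++ (drop a (take b w) ++ drop b w)
    ≡⟨ ++-assoc (take a (take b w)) (drop a (take b w)) (drop b w) ⟨
  (take a (take b w) ++ drop a (take b w)) ++ drop b w
    ≡⟨ cong (_++ drop b w) (take++drop≡id a (take b w)) ⟩
  take b w ++ drop b w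
    ≡⟨ take++drop≡id b w ⟩
  w ∎
  where
  open ≡-Reasoning
  take-a-take-b : take a w ≡ take a (take b w)
  take-a-take-b = sym (trans (take-take a b w) (cong (λ k → take k w) (m≤n⇒m⊓n≡m a≤b)))

≡ᵇ-true⇒≡ : ∀ x j → (x ≡ᵇ j) ≡ true → x ≡ j
≡ᵇ-true⇒≡ x j e = ≡ᵇ⇒≡ x j (subst T (sym e) tt)

≡ᵇ-false⇒≢ : ∀ x j → (x ≡ᵇ j) ≡ false → x ≢ j
≡ᵇ-false⇒≢ x j e x≡j = subst T e (≡⇒≡ᵇ x j x≡j)

pos-∈ : ∀ w j → j ∈ w → (1 ≤ pos w j) × (pos w j ≤ length w) × (at w (pos w j) ≡ j)
pos-∈ (x ∷ xs) j j∈ with x ≡ᵇ j in e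
... | true = s≤s z≤n , s≤s z≤n , ≡ᵇ-true⇒≡ x j e
... | false with j∈
...   | here j≡x = ⊥-elim (≡ᵇ-false⇒≢ x j e (sym j≡x))
...   | there j∈xs with pos xs j | pos-∈ xs j j∈xs
...     | suc k | _ , k<len , at-k = s≤s z≤n , s≤s k<len , at-k

pos≤length : ∀ w j → pos w j ≤ length w
pos≤length []       j = z≤n
pos≤length (x ∷ xs) j with x ≡ᵇ j
... | true = s≤s z≤n
... | false with pos xs j | pos≤length xs j
...   | zero  | _  = z≤n
...   | suc k | le = s≤s le

pos-nth : ∀ w i → Unique w → i < length w → pos w (nth w i) ≡ suc i
pos-nth (x ∷ xs) zero    _ _ with x ≡ᵇ x in e
... | true  = refl
... | false = ⊥-elim (≡ᵇ-false⇒≢ x x e refl)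
pos-nth (x ∷ xs) (suc i) (x∉xs ∷ u) (s≤s lt) with x ≡ᵇ nth xs i in e
... | true  = ⊥-elim (All.lookup x∉xs (nth∈ xs i lt) (≡ᵇ-true⇒≡ x _ e))
... | false rewrite pos-nth xs i u lt = refl

range : ℕ → ℕ → List ℕ
range s zero    = []
range s (suc k) = s ∷ range (suc s) k

∈-range⁻ : ∀ {v} s k → v ∈ range s k → s ≤ v × v < s + k
∈-range⁻ s (suc k) (here refl) = ≤-refl , subst (s <_) (sym (+-suc s k)) (s≤s (m≤m+n s k))
∈-range⁻ {v} s (suc k) (there v∈) with ∈-range⁻ (suc s) k v∈
... | s<v , v<s+k = <⇒≤ s<v , subst (v <_) (sym (+-suc s k)) v<s+k

∈-range⁺ : ∀ {v} s k → s ≤ v → v < s + k → v ∈ range s k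
∈-range⁺ {v} s zero    s≤v v<s = ⊥-elim (<⇒≱ v<s (subst (_≤ v) (sym (+-identityʳ s)) s≤v))
∈-range⁺ {v} s (suc k) s≤v v<s with s ≟ v
... | yes refl = here refl
... | no s≢v   = there (∈-range⁺ (suc s) k (≤∧≢⇒< s≤v s≢v) (subst (v <_) (+-suc s k) v<s))

range-increasing : ∀ s k → AllPairs _<_ (range s k)
range-increasing s zero    = []
range-increasing s (suc k) = All.tabulate (proj₁ ∘ ∈-range⁻ (suc s) k) ∷ range-increasing (suc s) k

length-range : ∀ s k → length (range s k) ≡ k
length-range s zero    = refl
length-range s (suc k) = cong suc (length-range (suc s) k)

nth-range : ∀ s k q → q < k → nth (range s k) q ≡ s + q
nth-range s (suc k) zero    _        = sym (+-identityʳ s)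
nth-range s (suc k) (suc q) (s≤s lt) = trans (nth-range (suc s) k q lt) (sym (+-suc s q))

oneTo≡range : ∀ n → oneTo n ≡ range 1 n
oneTo≡range n = trans (map-upTo suc n) (applyUpTo≡range suc 1 n (λ _ → refl))
  where
  applyUpTo≡range : ∀ f s k → (∀ i → f i ≡ s + i) → Data.List.applyUpTo f k ≡ range s k
  applyUpTo≡range f s zero    _  = refl
  applyUpTo≡range f s (suc k) eq = cong₂ _∷_ (trans (eq 0) (+-identityʳ s))
    (applyUpTo≡range (f ∘ suc) (suc s) k (λ i → trans (eq (suc i)) (+-suc s i)))

increasing-interval≡range : ∀ s S h → AllPairs _<_ (s ∷ S) → (∀ {v} → v ∈ s ∷ S → v ≤ h) →
  (∀ j → s ≤ j → j ≤ h → j ∈ s ∷ S) → s ∷ S ≡ range s (suc (h ∸ s))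
increasing-interval≡range s [] h _ bounded full with full h (bounded (here refl)) ≤-refl
... | here refl = cong (λ k → s ∷ range (suc s) k) (sym (n∸n≡0 s))
increasing-interval≡range s (t ∷ T) h ((s<t ∷ s<T) ∷ t<T ∷ incr) bounded full
  = trans (cong (s ∷_) (trans rest (cong (λ z → range z (suc (h ∸ z))) t≡1+s)))
          (cong (λ k → range s (suc k)) (sym (+-∸-assoc 1 (<-≤-trans s<t t≤h))))
  where
  t≤h : t ≤ h
  t≤h = bounded (there (here refl))
  t≡1+s : t ≡ suc s
  t≡1+s with full (suc s) (n≤1+n s) (≤-trans s<t t≤h)
  ... | here e              = ⊥-elim (<-irrefl (sym e) (n<1+n s))
  ... | there (here e)      = sym e
  ... | there (there 1+s∈T) = ⊥-elim (<⇒≱ (All.lookup t<T 1+s∈T) s<t)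
  full' : ∀ j → t ≤ j → j ≤ h → j ∈ t ∷ T
  full' j t≤j j≤h with full j (≤-trans (<⇒≤ s<t) t≤j) j≤h
  ... | here e    = ⊥-elim (<-irrefl (sym e) (<-≤-trans s<t t≤j))
  ... | there j∈  = j∈
  rest : t ∷ T ≡ range t (suc (h ∸ t))
  rest = increasing-interval≡range t T h (t<T ∷ incr) (bounded ∘ there) full'

insert-↭ : ∀ x ys → insert x ys ↭ x ∷ ys
insert-↭ x []       = ↭-refl
insert-↭ x (y ∷ ys) with x ≤ᵇ y
... | true  = ↭-refl
... | false = ↭-trans (↭-prep y (insert-↭ x ys)) (↭-swap y x ↭-refl)

isort-↭ : ∀ xs → isort xs ↭ xs
isort-↭ []       = ↭-refl
isort-↭ (x ∷ xs) = ↭-trans (insert-↭ x (isort xs)) (↭-prep x (isort-↭ xs))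

insert-increasing : ∀ x ys → AllPairs _<_ ys → x ∉ ys → AllPairs _<_ (insert x ys)
insert-increasing x []       _            _   = [] ∷ []
insert-increasing x (y ∷ ys) (y<ys ∷ inc) x∉ with x ≤ᵇ y in e
... | true  = (x<y ∷ All.map (<-trans x<y) y<ys) ∷ y<ys ∷ inc
  where
  x<y : x < y
  x<y = ≤∧≢⇒< (≤ᵇ⇒≤ x y (subst T (sym e) tt)) (x∉ ∘ here)
... | false = All-resp-↭ (↭-sym (insert-↭ x ys)) (y<x ∷ y<ys) ∷ insert-increasing x ys inc (x∉ ∘ there)
  where
  y<x : y < x
  y<x = ≰⇒> (λ x≤y → subst T e (≤⇒≤ᵇ x≤y))

isort-increasing : ∀ xs → Unique xs → AllPairs _<_ (isort xs)
isort-increasing []       _          = []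
isort-increasing (x ∷ xs) (x∉ ∷ u) = insert-increasing x (isort xs) (isort-increasing xs u)
  (λ x∈ → All.lookup x∉ (∈-resp-↭ (isort-↭ xs) x∈) refl)

swapAt-↭ : ∀ j w → swapAt j w ↭ w
swapAt-↭ zero          w           = ↭-refl
swapAt-↭ (suc zero)    []          = ↭-refl
swapAt-↭ (suc zero)    (x ∷ [])    = ↭-refl
swapAt-↭ (suc zero)    (x ∷ y ∷ r) = ↭-swap y x ↭-refl
swapAt-↭ (suc (suc k)) []          = ↭-refl
swapAt-↭ (suc (suc k)) (x ∷ r)     = ↭-prep x (swapAt-↭ (suc k) r)

nth-swapAt-left : ∀ k w → suc k < length w → nth (swapAt (suc k) w) k ≡ nth w (suc k)
nth-swapAt-left zero    (x ∷ y ∷ r) _        = refl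
nth-swapAt-left zero    (x ∷ [])    (s≤s ())
nth-swapAt-left (suc k) (x ∷ r)     (s≤s lt) = nth-swapAt-left k r lt

nth-swapAt-right : ∀ k w → suc k < length w → nth (swapAt (suc k) w) (suc k) ≡ nth w k
nth-swapAt-right zero    (x ∷ y ∷ r) _        = refl
nth-swapAt-right zero    (x ∷ [])    (s≤s ())
nth-swapAt-right (suc k) (x ∷ r)     (s≤s lt) = nth-swapAt-right k r lt

nth-swapAt-other : ∀ k w i → i ≢ k → i ≢ suc k → nth (swapAt (suc k) w) i ≡ nth w i
nth-swapAt-other zero    []          i             _   _   = refl
nth-swapAt-other zero    (x ∷ [])    i             _   _   = refl
nth-swapAt-other zero    (x ∷ y ∷ r) zero          i≢0 _   = ⊥-elim (i≢0 refl)
nth-swapAt-other zero    (x ∷ y ∷ r) (suc zero)    _   i≢1 = ⊥-elim (i≢1 refl)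
nth-swapAt-other zero    (x ∷ y ∷ r) (suc (suc i)) _   _   = refl
nth-swapAt-other (suc k) []          i             _   _   = refl
nth-swapAt-other (suc k) (x ∷ r)     zero          _   _   = refl
nth-swapAt-other (suc k) (x ∷ r)     (suc i)       i≢k i≢k+1 =
  nth-swapAt-other k r i (i≢k ∘ cong suc) (i≢k+1 ∘ cong suc)

sDesc-↭ : ∀ α c w → sDesc α c w ↭ w
sDesc-↭ α zero    w = ↭-refl
sDesc-↭ α (suc c) w = ↭-trans (sDesc-↭ α c _) (swapAt-↭ (α + suc c) w)

private
  swapAt-+-suc : ∀ α c w → swapAt (α + suc c) w ≡ swapAt (suc (α + c)) w
  swapAt-+-suc α c w = cong (λ k → swapAt k w) (+-suc α c)

  length-swapAt-+-suc : ∀ α c w → α + suc c < length w → α + c < length (swapAt (α + suc c) w)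
  length-swapAt-+-suc α c w lt =
    subst (α + c <_) (sym (↭-length (swapAt-↭ (α + suc c) w))) (<-trans (+-monoʳ-< α (n<1+n c)) lt)

nth-sDesc-< : ∀ α c w i → i < α → nth (sDesc α c w) i ≡ nth w i
nth-sDesc-< α zero    w i lt = refl
nth-sDesc-< α (suc c) w i lt rewrite nth-sDesc-< α c (swapAt (α + suc c) w) i lt | swapAt-+-suc α c w =
  nth-swapAt-other (α + c) w i (<⇒≢ (<-≤-trans lt (m≤m+n α c)))
                               (<⇒≢ (<-≤-trans lt (≤-trans (m≤m+n α c) (n≤1+n _))))

nth-sDesc-> : ∀ α c w i → α + c < i → nth (sDesc α c w) i ≡ nth w i
nth-sDesc-> α zero    w i lt = refl
nth-sDesc-> α (suc c) w i lt with <-trans (+-monoʳ-< α (n<1+n c)) lt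
... | α+c<i rewrite nth-sDesc-> α c (swapAt (α + suc c) w) i α+c<i | swapAt-+-suc α c w =
  nth-swapAt-other (α + c) w i (>⇒≢ α+c<i) (>⇒≢ (subst (_< i) (+-suc α c) lt))

nth-sDesc-first : ∀ α c w → α + c < length w → nth (sDesc α c w) α ≡ nth w (α + c)
nth-sDesc-first α zero    w lt = cong (nth w) (sym (+-identityʳ α))
nth-sDesc-first α (suc c) w lt
  rewrite nth-sDesc-first α c (swapAt (α + suc c) w) (length-swapAt-+-suc α c w lt)
        | swapAt-+-suc α c w | +-suc α c = nth-swapAt-left (α + c) w lt

nth-sDesc-shift : ∀ α c w q → α + c < length w → q < c → nth (sDesc α c w) (suc (α + q)) ≡ nth w (α + q)
nth-sDesc-shift α (suc c) w q lt (s≤s q≤c) with m≤n⇒m<n∨m≡n q≤c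
... | inj₁ q<c rewrite nth-sDesc-shift α c (swapAt (α + suc c) w) q (length-swapAt-+-suc α c w lt) q<c
                     | swapAt-+-suc α c w =
  nth-swapAt-other (α + c) w (α + q) (<⇒≢ (+-monoʳ-< α q<c)) (<⇒≢ (<-trans (+-monoʳ-< α q<c) (n<1+n _)))
... | inj₂ refl rewrite nth-sDesc-> α q (swapAt (α + suc q) w) (suc (α + q)) (n<1+n _)
                      | swapAt-+-suc α q w =
  nth-swapAt-right (α + q) w (subst (_< length w) (+-suc α q) lt)

increasing-filling⇒range : ∀ S b h → AllPairs _<_ S → length S ≡ suc b →
  (∀ {v} → v ∈ S → 1 ≤ v × v ≤ h) → (∀ j → 1 ≤ j → j ≤ h → j ∈ S ⊎ All (j <_) S) →
  suc b ≤ h × S ≡ range (suc (h ∸ suc b)) (suc b)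
increasing-filling⇒range (zero ∷ S)  b h _ _ bounded _ = ⊥-elim (1+n≰n (proj₁ (bounded (here refl))))
increasing-filling⇒range (suc s ∷ S) b h incr len bounded closed =
  subst (_≤ h) (+-comm b 1) b+1≤h , trans shape (cong₂ range s≡ (cong suc h∸s≡b))
  where
  s≤h : suc s ≤ h
  s≤h = proj₂ (bounded (here refl))
  full : ∀ j → suc s ≤ j → j ≤ h → j ∈ suc s ∷ S
  full j s≤j j≤h with closed j (≤-trans (s≤s z≤n) s≤j) j≤h
  ... | inj₁ j∈        = j∈
  ... | inj₂ (j<s ∷ _) = ⊥-elim (<⇒≱ j<s s≤j)
  shape : suc s ∷ S ≡ range (suc s) (suc (h ∸ suc s))
  shape = increasing-interval≡range (suc s) S h incr (proj₂ ∘ bounded) full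
  h∸s≡b : h ∸ suc s ≡ b
  h∸s≡b = suc-injective (trans (sym (length-range (suc s) _)) (trans (cong length (sym shape)) len))
  h≡b+s : h ≡ b + suc s
  h≡b+s = trans (sym (m∸n+n≡m s≤h)) (cong (_+ suc s) h∸s≡b)
  b+1≤h : b + 1 ≤ h
  b+1≤h = subst (b + 1 ≤_) (sym h≡b+s) (+-monoʳ-≤ b (s≤s z≤n))
  s≡ : suc s ≡ suc (h ∸ suc b)
  s≡ = cong suc (sym (trans (cong (_∸ suc b) (trans h≡b+s (+-suc b s))) (m+n∸m≡n b s)))

-- Sorting a window whose values form a gap-free top segment of [1, h]

module WindowSort (w : List ℕ) (α b h : ℕ) (w-unique : Unique w) (fits : α + suc b ≤ length w)
  (bounded : ∀ q → q < suc b → 1 ≤ nth w (α + q) × nth w (α + q) ≤ h)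
  (closed : ∀ j → 1 ≤ j → j ≤ h →
     (∃[ q ] (q < suc b × nth w (α + q) ≡ j)) ⊎ (∀ q → q < suc b → j < nth w (α + q)))
  where

  β t : ℕ
  β = suc b
  t = h ∸ β

  u : List ℕ
  u = sortWindow α (α + β) w

  private
    prefix suffix slice sorted : List ℕ
    prefix = take α w
    slice  = drop α (take (α + β) w)
    suffix = drop (α + β) w
    sorted = isort slice

    length-slice : length slice ≡ β
    length-slice = trans (length-drop α (take (α + β) w))
      (trans (cong (_∸ α) (length-take≤ (α + β) w fits)) (m+n∸m≡n α β))

    length-sorted : length sorted ≡ β
    length-sorted = trans (↭-length (isort-↭ slice)) length-slice

    length-prefix : length prefix ≡ α
    length-prefix = length-take≤ α w (≤-trans (m≤m+n α β) fits)

    nth-slice : ∀ q → q < β → nth slice q ≡ nth w (α + q)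
    nth-slice q lt = trans (nth-drop α (take (α + β) w) q) (nth-take (α + β) w (α + q) (+-monoʳ-< α lt))

    ∈-sorted⁻ : ∀ {v} → v ∈ sorted → ∃[ q ] (q < β × nth w (α + q) ≡ v)
    ∈-sorted⁻ v∈ with ∈⇒nth slice (∈-resp-↭ (isort-↭ slice) v∈)
    ... | q , lt , e with subst (q <_) length-slice lt
    ...   | q<β = q , q<β , trans (sym (nth-slice q q<β)) e

    ∈-sorted⁺ : ∀ q → q < β → nth w (α + q) ∈ sorted
    ∈-sorted⁺ q lt = ∈-resp-↭ (↭-sym (isort-↭ slice))
      (subst (_∈ slice) (nth-slice q lt) (nth∈ slice q (subst (q <_) (sym length-slice) lt)))

    sorted-range : β ≤ h × sorted ≡ range (suc t) β
    sorted-range = increasing-filling⇒range sorted b h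
      (isort-increasing slice (Unique.drop⁺ α (Unique.take⁺ (α + β) w-unique))) length-sorted
      bounds fills
      where
      bounds : ∀ {v} → v ∈ sorted → 1 ≤ v × v ≤ h
      bounds v∈ with ∈-sorted⁻ v∈
      ... | q , lt , refl = bounded q lt
      fills : ∀ j → 1 ≤ j → j ≤ h → j ∈ sorted ⊎ All (j <_) sorted
      fills j 1≤j j≤h with closed j 1≤j j≤h
      ... | inj₁ (q , lt , refl) = inj₁ (∈-sorted⁺ q lt)
      ... | inj₂ below = inj₂ (All.tabulate λ v∈ → case (∈-sorted⁻ v∈))
        where
        case : ∀ {v} → ∃[ q ] (q < β × nth w (α + q) ≡ v) → j < v
        case (q , lt , refl) = below q lt

  sortWindow-↭ : u ↭ w
  sortWindow-↭ = subst (u ↭_) (take++slice++drop α (α + β) w (m≤m+n α β))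
    (++⁺ˡ prefix (++⁺ʳ suffix (isort-↭ slice)))

  width≤h : β ≤ h
  width≤h = proj₁ sorted-range

  private
    nth-sortWindow-window : ∀ q → nth u (α + q) ≡ nth (sorted ++ suffix) q
    nth-sortWindow-window q = trans (cong (λ k → nth u (k + q)) (sym length-prefix)) (nth-++ʳ prefix (sorted ++ suffix) q)

  nth-sortWindow-outside : ∀ i → i < α ⊎ α + β ≤ i → nth u i ≡ nth w i
  nth-sortWindow-outside i (inj₁ lt) =
    trans (nth-++ˡ prefix (sorted ++ suffix) i (subst (i <_) (sym length-prefix) lt)) (nth-take α w i lt)
  nth-sortWindow-outside i (inj₂ le) with m≤n⇒∃[o]m+o≡n le
  ... | r , refl = begin
    nth u ((α + β) + r)                   ≡⟨ cong (nth u) (+-assoc α β r) ⟩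
    nth u (α + (β + r))                   ≡⟨ nth-sortWindow-window (β + r) ⟩
    nth (sorted ++ suffix) (β + r)        ≡⟨ cong (λ k → nth (sorted ++ suffix) (k + r)) (sym length-sorted) ⟩
    nth (sorted ++ suffix) (length sorted + r) ≡⟨ nth-++ʳ sorted suffix r ⟩
    nth suffix r                          ≡⟨ nth-drop (α + β) w r ⟩
    nth w ((α + β) + r)                   ∎
    where open ≡-Reasoning

  nth-sortWindow-inside : ∀ q → q < β → nth u (α + q) ≡ suc (t + q)
  nth-sortWindow-inside q lt = begin
    nth u (α + q)                 ≡⟨ nth-sortWindow-window q ⟩
    nth (sorted ++ suffix) q      ≡⟨ nth-++ˡ sorted suffix q (subst (q <_) (sym length-sorted) lt) ⟩
    nth sorted q                  ≡⟨ cong (λ S → nth S q) (proj₂ sorted-range) ⟩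
    nth (range (suc t) β) q       ≡⟨ nth-range (suc t) β q lt ⟩
    suc (t + q)                   ∎
    where open ≡-Reasoning

  window-above : ∀ q → q < β → t < nth w (α + q)
  window-above q lt = proj₁ (∈-range⁻ (suc t) β (subst (_ ∈_) (proj₂ sorted-range) (∈-sorted⁺ q lt)))

record PermView (n : ℕ) (w : List ℕ) : Set where
  field
    length≡ : length w ≡ n
    unique  : Unique w
    ∈⇒bounded : ∀ {v} → v ∈ w → 1 ≤ v × v ≤ n
    bounded⇒∈ : ∀ {v} → 1 ≤ v → v ≤ n → v ∈ w

isPerm⇒view : ∀ {n w} → IsPerm n w → PermView n w
isPerm⇒view {n} {w} w↭ = record
  { length≡   = trans (↭-length w↭) (trans (cong length (oneTo≡range n)) (length-range 1 n))
  ; unique    = Unique-resp-↭ (setoid ℕ) (↭⇒↭ₛ (↭-sym w↭′)) (AllPairs.map <⇒≢ (range-increasing 1 n))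
  ; ∈⇒bounded = λ v∈ → map₂ ≤-pred (∈-range⁻ 1 n (∈-resp-↭ w↭′ v∈))
  ; bounded⇒∈ = λ 1≤v v≤n → ∈-resp-↭ (↭-sym w↭′) (∈-range⁺ 1 n 1≤v (s≤s v≤n))
  }
  where
  w↭′ : w ↭ range 1 n
  w↭′ = subst (w ↭_) (oneTo≡range n) w↭

module PermViewProperties {n w} (P : PermView n w) where
  open PermView P

  at-bounded : ∀ i → 1 ≤ i → i ≤ n → 1 ≤ at w i × at w i ≤ n
  at-bounded (suc i) _ i<n rewrite at-suc w i = ∈⇒bounded (nth∈ w i (subst (i <_) (sym length≡) i<n))

  pos≤n : ∀ j → pos w j ≤ n
  pos≤n j = subst (pos w j ≤_) length≡ (pos≤length w j)

  pos-bounded : ∀ j → 1 ≤ j → j ≤ n → 1 ≤ pos w j × pos w j ≤ n × at w (pos w j) ≡ j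
  pos-bounded j 1≤j j≤n with pos-∈ w j (bounded⇒∈ 1≤j j≤n)
  ... | 1≤p , p≤len , at-p = 1≤p , subst (pos w j ≤_) length≡ p≤len , at-p

  pos-at : ∀ i → 1 ≤ i → i ≤ n → pos w (at w i) ≡ i
  pos-at (suc i) _ i<n rewrite at-suc w i = pos-nth w i unique (subst (i <_) (sym length≡) i<n)

  at≡⇒pos≡ : ∀ i j → 1 ≤ i → i ≤ n → at w i ≡ j → pos w j ≡ i
  at≡⇒pos≡ i j 1≤i i≤n refl = pos-at i 1≤i i≤n

  fixes-all⇒idPerm : (∀ i → 1 ≤ i → i ≤ n → at w i ≡ i) → w ≡ idPerm n
  fixes-all⇒idPerm fixes = nth-ext w (idPerm n) (trans length≡ (sym length-id)) same
    where
    length-id : length (idPerm n) ≡ n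
    length-id = trans (cong length (oneTo≡range n)) (length-range 1 n)
    same : ∀ i → nth w i ≡ nth (idPerm n) i
    same i with i <? n
    ... | yes i<n = begin
      nth w i               ≡⟨ at-suc w i ⟨
      at w (suc i)          ≡⟨ fixes (suc i) (s≤s z≤n) i<n ⟩
      suc i                 ≡⟨ nth-range 1 n i i<n ⟨
      nth (range 1 n) i     ≡⟨ cong (λ v → nth v i) (oneTo≡range n) ⟨
      nth (idPerm n) i      ∎
      where open ≡-Reasoning
    ... | no i≮n = trans (nth-≥length w i (subst (_≤ i) (sym length≡) (≮⇒≥ i≮n)))
                         (sym (nth-≥length (idPerm n) i (subst (_≤ i) (sym length-id) (≮⇒≥ i≮n))))

  fixes-all⇒Dominant : (∀ i → 1 ≤ i → i ≤ n → at w i ≡ i) → Dominant n w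
  fixes-all⇒Dominant fixes j 1≤j j≤n = 0 , λ i → mk⇔ (⊥-elim ∘ empty) (λ (1≤i , i≤0) → ⊥-elim (<⇒≱ 1≤i i≤0))
    where
    empty : ∀ {i} → InD w i j → ⊥
    empty {i} (1≤i , _ , i<pos , j<at) with subst (i <_) (at≡⇒pos≡ j j 1≤j j≤n (fixes j 1≤j j≤n)) i<pos
    ... | i<j = <-asym i<j (subst (j <_) (fixes i 1≤i (≤-trans (<⇒≤ i<j) j≤n)) j<at)

same-at⇒same-pos : ∀ {n u w} → PermView n u → PermView n w →
  ∀ j → 1 ≤ j → j ≤ n → at u (pos w j) ≡ at w (pos w j) → pos u j ≡ pos w j
same-at⇒same-pos {w = w} U W j 1≤j j≤n at≡ with PermViewProperties.pos-bounded W j 1≤j j≤n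
... | 1≤p , p≤n , at-p = PermViewProperties.at≡⇒pos≡ U (pos w j) j 1≤p p≤n (trans at≡ at-p)

-- Columns of the Rothe diagram

search-least : (P : ℕ → Set) → (∀ i → Dec (P i)) → (B : ℕ) →
  (∃[ i ] (i < B × P i × (∀ m → m < i → ¬ P m))) ⊎ (∀ i → i < B → ¬ P i)
search-least P P? zero = inj₂ (λ _ ())
search-least P P? (suc B) with search-least P P? B
... | inj₁ (i , i<B , Pi , least) = inj₁ (i , m<n⇒m<1+n i<B , Pi , least)
... | inj₂ none with P? B
...   | yes PB = inj₁ (B , n<1+n B , PB , none)
...   | no ¬PB = inj₂ λ i i<1+B → [ none i , (λ { refl → ¬PB }) ]′ (m≤n⇒m<n∨m≡n (≤-pred i<1+B))

InD? : ∀ w i j → Dec (InD w i j)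
InD? w i j = (1 ≤? i) ×-dec (1 ≤? j) ×-dec (i <? pos w j) ×-dec (j <? at w i)

MissingTooth? : ∀ w j i → Dec (MissingTooth w j i)
MissingTooth? w j i = (1 ≤? i) ×-dec ¬? (InD? w i j) ×-dec InD? w (suc i) j

InD⇒<length : ∀ {w i j} → InD w i j → i < length w
InD⇒<length {w} {i} {j} (_ , _ , i<pos , _) = <-≤-trans i<pos (pos≤length w j)

last-row+1∉D : ∀ w j → ¬ InD w (suc (length w)) j
last-row+1∉D w j in-D = n≮n _ (<-trans (n<1+n _) (InD⇒<length {w} in-D))

MissingTooth⇒<length : ∀ {w j i} → MissingTooth w j i → i < length w
MissingTooth⇒<length {w} (_ , _ , in-D) = <-trans (n<1+n _) (InD⇒<length {w} in-D)

noMissingTooth⇒StdCol : ∀ w j → (∀ i → ¬ MissingTooth w j i) → StdCol w j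
noMissingTooth⇒StdCol w j no-tooth
  with search-least (λ m → ¬ InD w (suc m) j) (λ m → ¬? (InD? w (suc m) j)) (suc (length w))
... | inj₂ none = ⊥-elim (none (length w) (n<1+n _) (last-row+1∉D w _))
... | inj₁ (k , _ , k+1∉ , below) = k , λ i → mk⇔ (bounded i) (filled i)
  where
  downward : ∀ m d → InD w (suc m + d) j → InD w (suc m) j
  downward m zero    in-D rewrite +-identityʳ m = in-D
  downward m (suc d) in-D rewrite +-suc m d =
    downward m d (decidable-stable (InD? w (suc m + d) j) (λ ∉D → no-tooth (suc m + d) (s≤s z≤n , ∉D , in-D)))
  bounded : ∀ i → InD w i j → (1 ≤ i) × (i ≤ k)
  bounded i in-D with i ≤? k
  ... | yes i≤k = proj₁ in-D , i≤k
  ... | no i≰k with m≤n⇒∃[o]m+o≡n (≰⇒> i≰k)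
  ...   | d , refl = ⊥-elim (k+1∉ (downward k d in-D))
  filled : ∀ i → (1 ≤ i) × (i ≤ k) → InD w i j
  filled (suc i) (_ , i<k) = decidable-stable (InD? w (suc i) j) (below i i<k)

StdCol-downClosed : ∀ w {j i r} → StdCol w j → InD w i j → 1 ≤ r → r ≤ i → InD w r j
StdCol-downClosed w {i = i} {r} (k , iff) in-D 1≤r r≤i = from (iff r) (1≤r , ≤-trans r≤i (proj₂ (to (iff i) in-D)))

StdCol⇒noMissingTooth : ∀ w j → StdCol w j → ∀ i → ¬ MissingTooth w j i
StdCol⇒noMissingTooth w j std i (1≤i , i∉ , i+1∈) = i∉ (StdCol-downClosed w std i+1∈ 1≤i (n≤1+n i))

leastMissingTooth : ∀ w j → (∃[ i ] (MissingTooth w j i × (∀ i′ → MissingTooth w j i′ → i ≤ i′))) ⊎ StdCol w j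
leastMissingTooth w j with search-least (MissingTooth w j) (MissingTooth? w j) (length w)
... | inj₁ (i , _ , tooth , least) = inj₁ (i , tooth , λ i′ tooth′ → ≮⇒≥ (λ i′<i → least i′ i′<i tooth′))
... | inj₂ none = inj₂ (noMissingTooth⇒StdCol w j λ i tooth → none i (MissingTooth⇒<length {w} tooth) tooth)

StdCol? : ∀ w j → Dec (StdCol w j)
StdCol? w j with leastMissingTooth w j
... | inj₁ (i , tooth , _) = no (λ std → StdCol⇒noMissingTooth w j std i tooth)
... | inj₂ std = yes std

primary-exists : ∀ n w → ∃[ h ] ∃[ α ] ∃[ i₁ ] Primary n w h α i₁
primary-exists n w with search-least (λ m → ¬ StdCol w (suc m)) (λ m → ¬? (StdCol? w (suc m))) n
... | inj₂ all-std = n , 0 , n , inj₁ (dominant , refl , refl , refl)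
  where
  dominant : Dominant n w
  dominant (suc m) _ m<n = decidable-stable (StdCol? w (suc m)) (all-std m m<n)
... | inj₁ (h , h<n , ¬std , std-below)
  with search-least (λ m → ¬ InD w (suc m) (suc h)) (λ m → ¬? (InD? w (suc m) (suc h))) (suc (length w))
...   | inj₂ none = ⊥-elim (none (length w) (n<1+n _) (last-row+1∉D w _))
...   | inj₁ (α , _ , α+1∉ , filled) with leastMissingTooth w (suc h)
...     | inj₂ std = ⊥-elim (¬std std)
...     | inj₁ (i₁ , tooth , least) = h , α , i₁ , inj₂ (h<n , ¬std , std , prefix , ¬prefix , tooth , least)
  where
  std : ∀ j → 1 ≤ j → j ≤ h → StdCol w j
  std (suc m) _ m<h = decidable-stable (StdCol? w (suc m)) (std-below m m<h)
  prefix : StdSubset w (suc h) α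
  prefix (suc i) _ i<α = decidable-stable (InD? w (suc i) (suc h)) (filled i i<α)
  ¬prefix : ¬ StdSubset w (suc h) (suc α)
  ¬prefix sub = α+1∉ (sub (suc α) (s≤s z≤n) ≤-refl)

primary-unique : ∀ {n w h α i₁ h′ α′ i₁′} → Primary n w h α i₁ → Primary n w h′ α′ i₁′ →
  h ≡ h′ × α ≡ α′ × i₁ ≡ i₁′
primary-unique (inj₁ (_ , refl , refl , refl)) (inj₁ (_ , refl , refl , refl)) = refl , refl , refl
primary-unique (inj₁ (dom , _)) (inj₂ (h′<n , ¬std′ , _)) = ⊥-elim (¬std′ (dom _ (s≤s z≤n) h′<n))
primary-unique (inj₂ (h<n , ¬std , _)) (inj₁ (dom , _)) = ⊥-elim (¬std (dom _ (s≤s z≤n) h<n))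
primary-unique {h = h} {h′ = h′} (inj₂ (_ , ¬std , std , pre , ¬pre , tooth , least))
                                 (inj₂ (_ , ¬std′ , std′ , pre′ , ¬pre′ , tooth′ , least′)) with <-cmp h h′
... | tri< h<h′ _ _ = ⊥-elim (¬std (std′ (suc h) (s≤s z≤n) h<h′))
... | tri> _ _ h>h′ = ⊥-elim (¬std′ (std (suc h′) (s≤s z≤n) h>h′))
... | tri≈ _ refl _ = refl , same-α , ≤-antisym (least _ tooth′) (least′ _ tooth)
  where
  same-α : _ ≡ _
  same-α with <-cmp _ _
  ... | tri< α<α′ _ _ = ⊥-elim (¬pre (λ i 1≤i i≤ → pre′ i 1≤i (≤-trans i≤ α<α′)))
  ... | tri> _ _ α>α′ = ⊥-elim (¬pre′ (λ i 1≤i i≤ → pre i 1≤i (≤-trans i≤ α>α′)))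
  ... | tri≈ _ α≡α′ _ = α≡α′

record SameColumn (u w : List ℕ) (j : ℕ) : Set where
  constructor sameColumn
  field cell : ∀ i → InD u i j ⇔ InD w i j

open SameColumn using (cell)

SameColumn-sym : ∀ {u w j} → SameColumn u w j → SameColumn w u j
SameColumn-sym same = sameColumn λ i → mk⇔ (from (cell same i)) (to (cell same i))

StdCol-transfer : ∀ {u w j} → SameColumn u w j → StdCol w j → StdCol u j
StdCol-transfer same (k , iff) = k , λ i → mk⇔ (to (iff i) ∘ to (cell same i)) (from (cell same i) ∘ from (iff i))

StdSubset-transfer : ∀ {u w j a} → SameColumn u w j → StdSubset w j a → StdSubset u j a
StdSubset-transfer same sub i 1≤i i≤a = from (cell same i) (sub i 1≤i i≤a)

MissingTooth-transfer : ∀ {u w j i} → SameColumn u w j → MissingTooth w j i → MissingTooth u j i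
MissingTooth-transfer {i = i} same (1≤i , i∉ , i+1∈) = 1≤i , i∉ ∘ to (cell same i) , from (cell same (suc i)) i+1∈

sameColumn-intro : ∀ u w j → pos u j ≡ pos w j →
  (∀ i → 1 ≤ i → i < pos w j → (j < at u i → j < at w i) × (j < at w i → j < at u i)) → SameColumn u w j
sameColumn-intro u w j pos≡ rows = sameColumn λ i → mk⇔
  (λ (1≤i , 1≤j , i<pos , j<at) → 1≤i , 1≤j , subst (i <_) pos≡ i<pos , proj₁ (rows i 1≤i (subst (i <_) pos≡ i<pos)) j<at)
  (λ (1≤i , 1≤j , i<pos , j<at) → 1≤i , 1≤j , subst (i <_) (sym pos≡) i<pos , proj₂ (rows i 1≤i i<pos) j<at)

StdCol-intro : ∀ u j k → 1 ≤ j → k < pos u j →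
  (∀ i → 1 ≤ i → i < pos u j → (j < at u i → i ≤ k) × (i ≤ k → j < at u i)) → StdCol u j
StdCol-intro u j k 1≤j k<pos rows = k , λ i → mk⇔
  (λ (1≤i , _ , i<pos , j<at) → 1≤i , proj₁ (rows i 1≤i i<pos) j<at)
  (λ (1≤i , i≤k) → 1≤i , 1≤j , <-≤-trans (s≤s i≤k) k<pos , proj₂ (rows i 1≤i (<-≤-trans (s≤s i≤k) k<pos)) i≤k)

NonDominantPrimary : ℕ → List ℕ → ℕ → ℕ → ℕ → Set
NonDominantPrimary n w h α i₁ =
    (h < n)
  × (¬ StdCol w (suc h))
  × (∀ j → 1 ≤ j → j ≤ h → StdCol w j)
  × StdSubset w (suc h) α
  × (¬ StdSubset w (suc h) (suc α))
  × MissingTooth w (suc h) i₁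
  × (∀ i → MissingTooth w (suc h) i → i₁ ≤ i)

Primary-transfer : ∀ {n u w h α i₁} → NonDominantPrimary n w h α i₁ → SameColumn u w (suc h) →
  (∀ j → 1 ≤ j → j ≤ h → StdCol u j) → Primary n u h α i₁
Primary-transfer (h<n , ¬std , _ , pre , ¬pre , tooth , least) same std =
  inj₂ ( h<n
       , ¬std ∘ StdCol-transfer (SameColumn-sym same)
       , std
       , StdSubset-transfer same pre
       , ¬pre ∘ StdSubset-transfer (SameColumn-sym same)
       , MissingTooth-transfer same tooth
       , λ i tooth′ → least i (MissingTooth-transfer (SameColumn-sym same) tooth′))

module NonDominantProperties {n w h α i₁} (P : PermView n w) (N : NonDominantPrimary n w h α i₁) where
  open PermViewProperties P

  h<n : h < n
  h<n = proj₁ N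

  prefix : StdSubset w (suc h) α
  prefix = proj₁ (proj₂ (proj₂ (proj₂ N)))

  tooth : MissingTooth w (suc h) i₁
  tooth = proj₁ (proj₂ (proj₂ (proj₂ (proj₂ (proj₂ N)))))

  least-tooth : ∀ i → MissingTooth w (suc h) i → i₁ ≤ i
  least-tooth = proj₂ (proj₂ (proj₂ (proj₂ (proj₂ (proj₂ N)))))

  std-below : ∀ j → 1 ≤ j → j ≤ h → StdCol w j
  std-below = proj₁ (proj₂ (proj₂ N))

  α+1∉column : ¬ InD w (suc α) (suc h)
  α+1∉column α+1∈ = proj₁ (proj₂ (proj₂ (proj₂ (proj₂ N)))) extended
    where
    extended : StdSubset w (suc h) (suc α)
    extended i 1≤i i≤α+1 with m≤n⇒m<n∨m≡n i≤α+1
    ... | inj₁ i<α+1 = prefix i 1≤i (≤-pred i<α+1)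
    ... | inj₂ refl  = α+1∈

  α<i₁ : α < i₁
  α<i₁ = ≰⇒> λ i₁≤α → proj₁ (proj₂ tooth) (prefix i₁ (proj₁ tooth) i₁≤α)

  i₁+1<pos : suc i₁ < pos w (suc h)
  i₁+1<pos = proj₁ (proj₂ (proj₂ (proj₂ (proj₂ tooth))))

  h+1<at-i₁+1 : suc h < at w (suc i₁)
  h+1<at-i₁+1 = proj₂ (proj₂ (proj₂ (proj₂ (proj₂ tooth))))

  i₁+1<n : suc i₁ < n
  i₁+1<n = <-≤-trans i₁+1<pos (pos≤n (suc h))

  prefix-above : ∀ i → 1 ≤ i → i ≤ α → suc h < at w i
  prefix-above i 1≤i i≤α = proj₂ (proj₂ (proj₂ (prefix i 1≤i i≤α)))

  -- A window row outside column h+1 followed by one inside it would be a missing tooth before i₁.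
  window∉column : ∀ r → α < r → r ≤ i₁ → ¬ InD w r (suc h)
  window∉column r α<r r≤i₁ with m≤n⇒∃[o]m+o≡n α<r
  ... | d , refl = go d r≤i₁
    where
    go : ∀ d → suc α + d ≤ i₁ → ¬ InD w (suc α + d) (suc h)
    go zero    _ rewrite +-identityʳ α = α+1∉column
    go (suc d) le in-D rewrite +-suc α d =
      <⇒≱ le (least-tooth (suc α + d) (s≤s z≤n , go d (≤-trans (n≤1+n _) le) , in-D))

  window-bounded : ∀ r → α < r → r ≤ i₁ → 1 ≤ at w r × at w r ≤ h
  window-bounded r α<r r≤i₁ = proj₁ (at-bounded r 1≤r r≤n) , ≤-pred (≤∧≢⇒< at≤h+1 at≢h+1)
    where
    1≤r : 1 ≤ r
    1≤r = ≤-trans (s≤s z≤n) α<r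
    r≤n : r ≤ n
    r≤n = ≤-trans r≤i₁ (≤-trans (n≤1+n i₁) (<⇒≤ i₁+1<n))
    r<pos : r < pos w (suc h)
    r<pos = <-trans (s≤s r≤i₁) i₁+1<pos
    at≤h+1 : at w r ≤ suc h
    at≤h+1 = ≮⇒≥ λ h+1<at → window∉column r α<r r≤i₁ (1≤r , s≤s z≤n , r<pos , h+1<at)
    at≢h+1 : at w r ≢ suc h
    at≢h+1 at≡ = <-irrefl (sym (at≡⇒pos≡ r (suc h) 1≤r r≤n at≡)) r<pos

  column-position : ∀ j → 1 ≤ j → j ≤ h →
    (α < pos w j × pos w j ≤ i₁) ⊎ (suc i₁ < pos w j × (∀ r → α < r → r ≤ i₁ → j < at w r))
  column-position j 1≤j j≤h with pos-bounded j 1≤j (≤-trans j≤h (<⇒≤ h<n))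
  ... | 1≤p , p≤n , at-p with pos w j ≤? α
  ...   | yes p≤α = ⊥-elim (<⇒≱ (prefix-above (pos w j) 1≤p p≤α) (subst (_≤ suc h) (sym at-p) (m≤n⇒m≤1+n j≤h)))
  ...   | no p≰α with pos w j ≤? i₁
  ...     | yes p≤i₁ = inj₁ (≰⇒> p≰α , p≤i₁)
  ...     | no p≰i₁ with pos w j ≟ suc i₁
  ...       | yes p≡i₁+1 =
    ⊥-elim (<⇒≱ h+1<at-i₁+1 (subst (_≤ suc h) (trans (sym at-p) (cong (at w) p≡i₁+1)) (m≤n⇒m≤1+n j≤h)))
  ...       | no p≢i₁+1 = inj₂ (i₁+1<p , above)
    where
    i₁+1<p : suc i₁ < pos w j
    i₁+1<p = ≤∧≢⇒< (≰⇒> p≰i₁) (p≢i₁+1 ∘ sym)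
    above : ∀ r → α < r → r ≤ i₁ → j < at w r
    above r α<r r≤i₁ = proj₂ (proj₂ (proj₂ (StdCol-downClosed w (std-below j 1≤j j≤h)
      (s≤s z≤n , 1≤j , i₁+1<p , <-trans (s≤s j≤h) h+1<at-i₁+1) (≤-trans (s≤s z≤n) α<r) (m≤n⇒m≤1+n r≤i₁))))

  low-column-position : ∀ t → t ≤ h → (∀ r → α < r → r ≤ i₁ → t < at w r) →
    ∀ j → 1 ≤ j → j ≤ t → suc i₁ < pos w j × (∀ r → α < r → r ≤ i₁ → j < at w r)
  low-column-position t t≤h window-above j 1≤j j≤t with column-position j 1≤j (≤-trans j≤t t≤h)
  ... | inj₂ outside = outside
  ... | inj₁ (α<p , p≤i₁) = ⊥-elim (<⇒≱ (window-above (pos w j) α<p p≤i₁) (subst (_≤ t) (sym at-p) j≤t))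
    where
    at-p : at w (pos w j) ≡ j
    at-p = proj₂ (proj₂ (pos-bounded j 1≤j (≤-trans (≤-trans j≤t t≤h) (<⇒≤ h<n))))

data RowPosition (α β i : ℕ) : Set where
  before : i ≤ α → RowPosition α β i
  inside : ∀ q → q < β → i ≡ suc (α + q) → RowPosition α β i
  after  : α + β < i → RowPosition α β i

rowPosition : ∀ α β i → 1 ≤ i → RowPosition α β i
rowPosition α β (suc i) _ with i <? α
... | yes i<α = before i<α
... | no i≮α with m≤n⇒∃[o]m+o≡n (≮⇒≥ i≮α)
...   | q , α+q≡i with q <? β
...     | yes q<β = inside q q<β (cong suc (sym α+q≡i))
...     | no q≮β  = after (s≤s (subst (α + β ≤_) α+q≡i (+-monoʳ-≤ α (≮⇒≥ q≮β))))

window-row : ∀ α β q → q < β → α < suc (α + q) × suc (α + q) ≤ α + β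
window-row α β q q<β = s≤s (m≤m+n α q) , +-monoʳ-< α q<β

window-row⁻ : ∀ α β r → α < r → r ≤ α + β → ∃[ q ] (q < β × r ≡ suc (α + q))
window-row⁻ α β r α<r r≤α+β with m≤n⇒∃[o]m+o≡n α<r
... | q , refl = q , +-cancelˡ-< α q β r≤α+β , refl

StdCol-split : ∀ u w t β → (∀ j → 1 ≤ j → j ≤ t → SameColumn u w j) →
  (∀ q → q < β → StdCol u (suc (t + q))) → ∀ {h} → t + β ≡ h →
  (∀ j → 1 ≤ j → j ≤ h → StdCol w j) → ∀ j → 1 ≤ j → j ≤ h → StdCol u j
StdCol-split u w t β same std-block refl std-w j 1≤j j≤t+β with j ≤? t
... | yes j≤t = StdCol-transfer (same j 1≤j j≤t) (std-w j 1≤j j≤t+β)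
... | no j≰t with m≤n⇒∃[o]m+o≡n (≰⇒> j≰t)
...   | q , refl = std-block q (+-cancelˡ-< t q β j≤t+β)

sorted-window-value : ∀ w h α b → Sorted w h α (α + suc b) →
  ∀ q → q < suc b → at w (suc (α + q)) ≡ suc (h ∸ suc b + q)
sorted-window-value w h α b w-sorted q q<β =
  trans (sym (m+[n∸m]≡n t≤at)) (trans (cong (h ∸ suc b +_) sorted-q) (+-suc (h ∸ suc b) q))
  where
  i₁∸α≡β : α + suc b ∸ α ≡ suc b
  i₁∸α≡β = m+n∸m≡n α (suc b)
  sorted-q : at w (suc (α + q)) ∸ (h ∸ suc b) ≡ suc q
  sorted-q = trans (cong₂ _∸_ (cong (at w) (sym (+-suc α q))) (cong (h ∸_) (sym i₁∸α≡β)))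
                   (w-sorted (suc q) (s≤s z≤n) (subst (suc q ≤_) (sym i₁∸α≡β) q<β))
  t≤at : h ∸ suc b ≤ at w (suc (α + q))
  t≤at = ≮⇒≥ λ at<t → 0≢1+n (trans (sym (m≤n⇒m∸n≡0 (<⇒≤ at<t))) sorted-q)

-- The sorting step

module SortStep {n w h α b} (w-perm : IsPerm n w) (N : NonDominantPrimary n w h α (α + suc b)) where
  private
    P : PermView n w
    P = isPerm⇒view w-perm
  open PermView P
  open PermViewProperties P
  open NonDominantProperties P N

  private
    i₁ : ℕ
    i₁ = α + suc b

    fits : i₁ ≤ length w
    fits = subst (i₁ ≤_) (sym length≡) (≤-trans (n≤1+n i₁) (<⇒≤ i₁+1<n))

    window-values-bounded : ∀ q → q < suc b → 1 ≤ nth w (α + q) × nth w (α + q) ≤ h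
    window-values-bounded q q<β rewrite sym (at-suc w (α + q)) =
      window-bounded (suc (α + q)) (proj₁ (window-row α (suc b) q q<β)) (proj₂ (window-row α (suc b) q q<β))

    window-values-closed : ∀ j → 1 ≤ j → j ≤ h →
      (∃[ q ] (q < suc b × nth w (α + q) ≡ j)) ⊎ (∀ q → q < suc b → j < nth w (α + q))
    window-values-closed j 1≤j j≤h with column-position j 1≤j j≤h
    ... | inj₂ (_ , above) = inj₂ λ q q<β → subst (j <_) (at-suc w (α + q))
            (above _ (proj₁ (window-row α (suc b) q q<β)) (proj₂ (window-row α (suc b) q q<β)))
    ... | inj₁ (α<p , p≤i₁) with window-row⁻ α (suc b) (pos w j) α<p p≤i₁
    ...   | q , q<β , p≡ = inj₁ (q , q<β , (begin
      nth w (α + q)      ≡⟨ at-suc w (α + q) ⟨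
      at w (suc (α + q)) ≡⟨ cong (at w) p≡ ⟨
      at w (pos w j)     ≡⟨ proj₂ (proj₂ (pos-bounded j 1≤j (≤-trans j≤h (<⇒≤ h<n)))) ⟩
      j                  ∎))
      where open ≡-Reasoning

  open WindowSort w α b h unique fits window-values-bounded window-values-closed

  u-perm : IsPerm n u
  u-perm = ↭-trans sortWindow-↭ w-perm

  private
    U : PermView n u
    U = isPerm⇒view u-perm
    module U = PermViewProperties U

    t+β≡h : t + β ≡ h
    t+β≡h = m∸n+n≡m width≤h

    at-u-before : ∀ i → i ≤ α → at u i ≡ at w i
    at-u-before zero    _   = trans (at-zero u) (sym (at-zero w))
    at-u-before (suc i) i<α = trans (at-suc u i) (trans (nth-sortWindow-outside i (inj₁ i<α)) (sym (at-suc w i)))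

    at-u-after : ∀ i → i₁ < i → at u i ≡ at w i
    at-u-after (suc i) (s≤s i₁≤i) =
      trans (at-suc u i) (trans (nth-sortWindow-outside i (inj₂ i₁≤i)) (sym (at-suc w i)))

    at-u-inside : ∀ q → q < β → at u (suc (α + q)) ≡ suc (t + q)
    at-u-inside q q<β = trans (at-suc u (α + q)) (nth-sortWindow-inside q q<β)

    window-value≤h : ∀ q → q < β → suc (t + q) ≤ h
    window-value≤h q q<β = subst (suc (t + q) ≤_) t+β≡h (+-monoʳ-< t q<β)

    window-at-above : ∀ r → α < r → r ≤ i₁ → t < at w r
    window-at-above r α<r r≤i₁ with window-row⁻ α β r α<r r≤i₁
    ... | q , q<β , refl = subst (t <_) (sym (at-suc w (α + q))) (window-above q q<β)

    same-low-column : ∀ j → 1 ≤ j → j ≤ t → SameColumn u w j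
    same-low-column j 1≤j j≤t with low-column-position t (m∸n≤m h β) window-at-above j 1≤j j≤t
    ... | i₁+1<p , above = sameColumn-intro u w j pos≡ rows
      where
      pos≡ : pos u j ≡ pos w j
      pos≡ = same-at⇒same-pos U P j 1≤j (≤-trans (≤-trans j≤t (m∸n≤m h β)) (<⇒≤ h<n))
               (at-u-after (pos w j) (<-trans (n<1+n i₁) i₁+1<p))
      rows : ∀ i → 1 ≤ i → i < pos w j → (j < at u i → j < at w i) × (j < at w i → j < at u i)
      rows i 1≤i _ with rowPosition α β i 1≤i
      ... | before i≤α = subst (j <_) (at-u-before i i≤α) , subst (j <_) (sym (at-u-before i i≤α))
      ... | after i₁<i = subst (j <_) (at-u-after i i₁<i) , subst (j <_) (sym (at-u-after i i₁<i))
      ... | inside q q<β refl = (λ _ → above _ (proj₁ (window-row α β q q<β)) (proj₂ (window-row α β q q<β)))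
                              , (λ _ → subst (j <_) (sym (at-u-inside q q<β)) (s≤s (≤-trans j≤t (m≤m+n t q))))

    same-column-h+1 : SameColumn u w (suc h)
    same-column-h+1 = sameColumn-intro u w (suc h) pos≡ rows
      where
      pos≡ : pos u (suc h) ≡ pos w (suc h)
      pos≡ = same-at⇒same-pos U P (suc h) (s≤s z≤n) h<n (at-u-after (pos w (suc h)) (<-trans (n<1+n i₁) i₁+1<pos))
      rows : ∀ i → 1 ≤ i → i < pos w (suc h) → (suc h < at u i → suc h < at w i) × (suc h < at w i → suc h < at u i)
      rows i 1≤i _ with rowPosition α β i 1≤i
      ... | before i≤α = subst (suc h <_) (at-u-before i i≤α) , subst (suc h <_) (sym (at-u-before i i≤α))
      ... | after i₁<i = subst (suc h <_) (at-u-after i i₁<i) , subst (suc h <_) (sym (at-u-after i i₁<i))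
      ... | inside q q<β refl =
          (λ h+1< → ⊥-elim (<⇒≱ h+1< (subst (_≤ suc h) (sym (at-u-inside q q<β)) (m≤n⇒m≤1+n (window-value≤h q q<β)))))
        , (λ h+1< → ⊥-elim (<⇒≱ h+1< (m≤n⇒m≤1+n (proj₂ (window-bounded _ (proj₁ (window-row α β q q<β))
                                                                         (proj₂ (window-row α β q q<β)))))))

    -- after sorting, value t+1+q sits in row α+1+q, so column t+1+q is exactly [α]
    block-std : ∀ q → q < β → StdCol u (suc (t + q))
    block-std q q<β = StdCol-intro u j α (s≤s z≤n) (subst (α <_) (sym pos≡) (s≤s (m≤m+n α q))) rows
      where
      j : ℕ
      j = suc (t + q)
      pos≡ : pos u j ≡ suc (α + q)
      pos≡ = U.at≡⇒pos≡ (suc (α + q)) j (s≤s z≤n)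
               (≤-trans (proj₂ (window-row α β q q<β)) (≤-trans (n≤1+n i₁) (<⇒≤ i₁+1<n))) (at-u-inside q q<β)
      rows : ∀ i → 1 ≤ i → i < pos u j → (j < at u i → i ≤ α) × (i ≤ α → j < at u i)
      rows i 1≤i i<pos with rowPosition α β i 1≤i
      ... | before i≤α = (λ _ → i≤α) , λ _ → subst (j <_) (sym (at-u-before i i≤α))
                                              (<-trans (s≤s (window-value≤h q q<β)) (prefix-above i 1≤i i≤α))
      ... | after i₁<i = ⊥-elim (<⇒≱ (subst (i <_) pos≡ i<pos) (≤-trans (proj₂ (window-row α β q q<β)) (<⇒≤ i₁<i)))
      ... | inside q′ q′<β refl = (λ j<at → ⊥-elim (<⇒≱ (subst (j <_) (at-u-inside q′ q′<β) j<at) value<j))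
                                , (λ i≤α → ⊥-elim (<⇒≱ (s≤s (m≤m+n α q′)) i≤α))
        where
        q′<q : q′ < q
        q′<q = +-cancelˡ-< α q′ q (≤-pred (subst (suc (α + q′) <_) pos≡ i<pos))
        value<j : suc (t + q′) ≤ j
        value<j = s≤s (+-monoʳ-≤ t (<⇒≤ q′<q))

  sortWindow-primary : Primary n u h α i₁
  sortWindow-primary = Primary-transfer N same-column-h+1 (StdCol-split u w t β same-low-column block-std t+β≡h std-below)

  private
    i₁∸α≡β : i₁ ∸ α ≡ β
    i₁∸α≡β = m+n∸m≡n α β

  sortWindow-sorted : Sorted u h α i₁
  sortWindow-sorted (suc q) _ q<β rewrite i₁∸α≡β | +-suc α q =
    trans (cong (_∸ t) (at-u-inside q q<β)) (trans (cong (_∸ t) (sym (+-suc t q))) (m+n∸m≡n t (suc q)))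

  sorted⇒sortWindow≡ : Sorted w h α i₁ → u ≡ w
  sorted⇒sortWindow≡ w-sorted = nth-ext u w (↭-length sortWindow-↭) same
    where
    same : ∀ i → nth u i ≡ nth w i
    same i with rowPosition α β (suc i) (s≤s z≤n)
    ... | before i<α = nth-sortWindow-outside i (inj₁ i<α)
    ... | after (s≤s i₁≤i) = nth-sortWindow-outside i (inj₂ i₁≤i)
    ... | inside q q<β refl =
      trans (nth-sortWindow-inside q q<β) (sym (trans (sym (at-suc w (α + q))) (sorted-window-value w h α b w-sorted q q<β)))

-- The cycling step

lex-< : ∀ n h α h′ α′ → α < suc n → h < h′ → h * suc n + α < h′ * suc n + α′
lex-< n h α h′ α′ α<n+1 h<h′ = begin-strict
  h * suc n + α      <⟨ +-monoʳ-< (h * suc n) α<n+1 ⟩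
  h * suc n + suc n  ≡⟨ +-comm (h * suc n) (suc n) ⟩
  suc h * suc n      ≤⟨ *-monoˡ-≤ (suc n) h<h′ ⟩
  h′ * suc n         ≤⟨ m≤m+n (h′ * suc n) α′ ⟩
  h′ * suc n + α′    ∎
  where open ≤-Reasoning

module CycleStep {n w h α b} (w-perm : IsPerm n w) (N : NonDominantPrimary n w h α (α + suc b))
                 (w-sorted : Sorted w h α (α + suc b)) where
  private
    P : PermView n w
    P = isPerm⇒view w-perm
  open PermView P
  open PermViewProperties P
  open NonDominantProperties P N

  private
    β i₁ t : ℕ
    β  = suc b
    i₁ = α + β
    t  = h ∸ β

  u : List ℕ
  u = sDesc α β w

  u-perm : IsPerm n u
  u-perm = ↭-trans (sDesc-↭ α β w) w-perm

  private
    U : PermView n u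
    U = isPerm⇒view u-perm
    module U = PermViewProperties U

    i₁<length : i₁ < length w
    i₁<length = subst (i₁ <_) (sym length≡) (<-trans (n<1+n i₁) i₁+1<n)

    window-value : ∀ q → q < β → at w (suc (α + q)) ≡ suc (t + q)
    window-value = sorted-window-value w h α b w-sorted

    t+β≡h : t + β ≡ h
    t+β≡h = m∸n+n≡m (≤-trans (m≤n+m β t) t+β≤h)
      where
      t+β≤h : t + β ≤ h
      t+β≤h = subst (_≤ h) (trans (window-value b ≤-refl) (sym (+-suc t b)))
                (proj₂ (window-bounded _ (proj₁ (window-row α β b ≤-refl)) (proj₂ (window-row α β b ≤-refl))))

    window-value≤h : ∀ q → q < β → suc (t + q) ≤ h
    window-value≤h q q<β = subst (suc (t + q) ≤_) t+β≡h (+-monoʳ-< t q<β)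

    at-u-before : ∀ i → i ≤ α → at u i ≡ at w i
    at-u-before zero    _   = trans (at-zero u) (sym (at-zero w))
    at-u-before (suc i) i<α = trans (at-suc u i) (trans (nth-sDesc-< α β w i i<α) (sym (at-suc w i)))

    at-u-α+1 : at u (suc α) ≡ at w (suc i₁)
    at-u-α+1 = trans (at-suc u α) (trans (nth-sDesc-first α β w i₁<length) (sym (at-suc w i₁)))

    at-u-shifted : ∀ q → q < β → at u (suc (suc (α + q))) ≡ suc (t + q)
    at-u-shifted q q<β = trans (at-suc u (suc (α + q)))
      (trans (nth-sDesc-shift α β w q i₁<length q<β) (trans (sym (at-suc w (α + q))) (window-value q q<β)))

    at-u-after : ∀ i → suc i₁ < i → at u i ≡ at w i
    at-u-after (suc i) (s≤s i₁<i) = trans (at-suc u i) (trans (nth-sDesc-> α β w i i₁<i) (sym (at-suc w i)))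

    window-at-above : ∀ r → α < r → r ≤ i₁ → t < at w r
    window-at-above r α<r r≤i₁ with window-row⁻ α β r α<r r≤i₁
    ... | q , q<β , refl = subst (t <_) (sym (window-value q q<β)) (s≤s (m≤m+n t q))

    same-low-column : ∀ j → 1 ≤ j → j ≤ t → SameColumn u w j
    same-low-column j 1≤j j≤t with low-column-position t (m∸n≤m h β) window-at-above j 1≤j j≤t
    ... | i₁+1<p , above = sameColumn-intro u w j pos≡ rows
      where
      j≤h : j ≤ h
      j≤h = ≤-trans j≤t (m∸n≤m h β)
      pos≡ : pos u j ≡ pos w j
      pos≡ = same-at⇒same-pos U P j 1≤j (≤-trans j≤h (<⇒≤ h<n)) (at-u-after (pos w j) i₁+1<p)
      above′ : ∀ r → α < r → r ≤ suc i₁ → j < at w r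
      above′ r α<r r≤i₁+1 with m≤n⇒m<n∨m≡n r≤i₁+1
      ... | inj₁ r<i₁+1 = above r α<r (≤-pred r<i₁+1)
      ... | inj₂ refl   = <-trans (s≤s j≤h) h+1<at-i₁+1
      rows : ∀ i → 1 ≤ i → i < pos w j → (j < at u i → j < at w i) × (j < at w i → j < at u i)
      rows i 1≤i _ with rowPosition α (suc β) i 1≤i
      ... | before i≤α = subst (j <_) (at-u-before i i≤α) , subst (j <_) (sym (at-u-before i i≤α))
      ... | after i₁+1<i =
          subst (j <_) (at-u-after i (subst (_< i) (+-suc α β) i₁+1<i))
        , subst (j <_) (sym (at-u-after i (subst (_< i) (+-suc α β) i₁+1<i)))
      ... | inside zero _ refl rewrite +-identityʳ α =
          (λ _ → above′ (suc α) ≤-refl (s≤s (<⇒≤ α<i₁)))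
        , (λ _ → subst (j <_) (sym at-u-α+1) (<-trans (s≤s j≤h) h+1<at-i₁+1))
      ... | inside (suc q) q+1<β+1 refl rewrite +-suc α q =
          (λ _ → above′ _ (s≤s (≤-trans (m≤m+n α q) (n≤1+n _))) (s≤s (proj₂ (window-row α β q (≤-pred q+1<β+1)))))
        , (λ _ → subst (j <_) (sym (at-u-shifted q (≤-pred q+1<β+1))) (s≤s (≤-trans j≤t (m≤m+n t q))))

    -- the cycle moves value t+1+q down to row α+2+q, below the large value moved up to row α+1
    block-std : ∀ q → q < β → StdCol u (suc (t + q))
    block-std q q<β = StdCol-intro u j (suc α) (s≤s z≤n) (subst (suc α <_) (sym pos≡) (s≤s (s≤s (m≤m+n α q)))) rows
      where
      j : ℕ
      j = suc (t + q)
      j<h+1 : j < suc h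
      j<h+1 = s≤s (window-value≤h q q<β)
      pos≡ : pos u j ≡ suc (suc (α + q))
      pos≡ = U.at≡⇒pos≡ (suc (suc (α + q))) j (s≤s z≤n)
               (≤-trans (s≤s (proj₂ (window-row α β q q<β))) (<⇒≤ i₁+1<n)) (at-u-shifted q q<β)
      rows : ∀ i → 1 ≤ i → i < pos u j → (j < at u i → i ≤ suc α) × (i ≤ suc α → j < at u i)
      rows i 1≤i i<pos with rowPosition α (suc β) i 1≤i
      ... | before i≤α = (λ _ → m≤n⇒m≤1+n i≤α)
                       , λ _ → subst (j <_) (sym (at-u-before i i≤α)) (<-trans j<h+1 (prefix-above i 1≤i i≤α))
      ... | after i₁+1<i = ⊥-elim (<⇒≱ (subst (i <_) pos≡ i<pos)
          (≤-trans (s≤s (proj₂ (window-row α β q q<β))) (<⇒≤ (subst (_< i) (+-suc α β) i₁+1<i))))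
      ... | inside zero _ refl rewrite +-identityʳ α =
          (λ _ → ≤-refl) , λ _ → subst (j <_) (sym at-u-α+1) (<-trans j<h+1 h+1<at-i₁+1)
      ... | inside (suc q′) q′+1<β+1 refl rewrite +-suc α q′ =
          (λ j<at → ⊥-elim (<⇒≱ (subst (j <_) (at-u-shifted q′ (≤-pred q′+1<β+1)) j<at) value<j))
        , (λ i≤α+1 → ⊥-elim (<⇒≱ (s≤s (m≤m+n α q′)) (≤-pred i≤α+1)))
        where
        q′<q : q′ < q
        q′<q = +-cancelˡ-< α q′ q (≤-pred (≤-pred (subst (suc (suc (α + q′)) <_) pos≡ i<pos)))
        value<j : suc (t + q′) ≤ j
        value<j = s≤s (+-monoʳ-≤ t (<⇒≤ q′<q))

    -- row α+1 now carries w(i₁+1) > h+1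
    column-h+1-prefix : StdSubset u (suc h) (suc α)
    column-h+1-prefix i 1≤i i≤α+1 = 1≤i , s≤s z≤n , subst (i <_) (sym pos≡) i<pos , above
      where
      i<pos : i < pos w (suc h)
      i<pos = <-trans (s≤s (≤-trans i≤α+1 α<i₁)) i₁+1<pos
      pos≡ : pos u (suc h) ≡ pos w (suc h)
      pos≡ = same-at⇒same-pos U P (suc h) (s≤s z≤n) h<n (at-u-after (pos w (suc h)) i₁+1<pos)
      above : suc h < at u i
      above with m≤n⇒m<n∨m≡n i≤α+1
      ... | inj₁ i<α+1 = subst (suc h <_) (sym (at-u-before i (≤-pred i<α+1))) (prefix-above i 1≤i (≤-pred i<α+1))
      ... | inj₂ refl  = subst (suc h <_) (sym at-u-α+1) h+1<at-i₁+1

    std-below-u : ∀ j → 1 ≤ j → j ≤ h → StdCol u j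
    std-below-u = StdCol-split u w t β same-low-column block-std t+β≡h std-below

    α<n+1 : α < suc n
    α<n+1 = <-trans (<-trans α<i₁ (<-trans (n<1+n i₁) i₁+1<n)) (n<1+n n)

  sDesc-primary-increases : ∀ h′ α′ i₁′ → Primary n u h′ α′ i₁′ → h * suc n + α < h′ * suc n + α′
  sDesc-primary-increases h′ α′ i₁′ (inj₁ (_ , refl , refl , refl)) = lex-< n h α n 0 α<n+1 h<n
  sDesc-primary-increases h′ α′ i₁′ (inj₂ (_ , ¬std′ , _ , _ , ¬pre′ , _)) with <-cmp h h′
  ... | tri< h<h′ _ _ = lex-< n h α h′ α′ α<n+1 h<h′
  ... | tri> _ _ h′<h = ⊥-elim (¬std′ (std-below-u (suc h′) (s≤s z≤n) h′<h))
  ... | tri≈ _ refl _ = +-monoʳ-< (h * suc n) (≰⇒> λ α′≤α →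
          ¬pre′ λ i 1≤i i≤α′+1 → column-h+1-prefix i 1≤i (≤-trans i≤α′+1 (s≤s α′≤α)))

record SortOutcome (n : ℕ) (w : List ℕ) (h α i₁ : ℕ) : Set where
  field
    perm         : IsPerm n (sortWindow α i₁ w)
    primary      : Primary n (sortWindow α i₁ w) h α i₁
    sorted       : Sorted (sortWindow α i₁ w) h α i₁
    fixes-sorted : Sorted w h α i₁ → sortWindow α i₁ w ≡ w

sortedDominant⇒idPerm : ∀ {n w} → IsPerm n w → Sorted w n 0 n → w ≡ idPerm n
sortedDominant⇒idPerm {n} {w} w-perm w-sorted = PermViewProperties.fixes-all⇒idPerm (isPerm⇒view w-perm)
  λ i 1≤i i≤n → trans (cong (at w i ∸_) (sym (n∸n≡0 n))) (w-sorted i 1≤i i≤n)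

sortOutcome-dominant : ∀ n w → IsPerm n w → Dominant n w → SortOutcome n w n 0 n
sortOutcome-dominant zero [] w-perm dominant = record
  { perm = w-perm ; primary = inj₁ (dominant , refl , refl , refl) ; sorted = λ { (suc _) _ () } ; fixes-sorted = λ _ → refl }
sortOutcome-dominant zero (_ ∷ _) w-perm _ with ↭-length w-perm
... | ()
sortOutcome-dominant (suc b) w w-perm _ = record
  { perm = u-perm
  ; primary = inj₁ (U.fixes-all⇒Dominant fixes , refl , refl , refl)
  ; sorted = λ p 1≤p p≤n → trans (cong (at u p ∸_) (n∸n≡0 n)) (fixes p 1≤p p≤n)
  ; fixes-sorted = λ w-sorted → trans (U.fixes-all⇒idPerm fixes) (sym (sortedDominant⇒idPerm w-perm w-sorted))
  }
  where
  n : ℕ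
  n = suc b
  P : PermView n w
  P = isPerm⇒view w-perm
  open PermView P
  open PermViewProperties P
  all-bounded : ∀ q → q < n → 1 ≤ nth w q × nth w q ≤ n
  all-bounded q q<n = subst (λ v → 1 ≤ v × v ≤ n) (at-suc w q) (at-bounded (suc q) (s≤s z≤n) q<n)
  all-present : ∀ j → 1 ≤ j → j ≤ n → (∃[ q ] (q < n × nth w q ≡ j)) ⊎ (∀ q → q < n → j < nth w q)
  all-present j 1≤j j≤n with pos w j | pos-bounded j 1≤j j≤n
  ... | suc q | _ , q<n , at-q = inj₁ (q , q<n , trans (sym (at-suc w q)) at-q)
  open WindowSort w 0 b n unique (subst (n ≤_) (sym length≡) ≤-refl) all-bounded all-present
  u-perm : IsPerm n u
  u-perm = ↭-trans sortWindow-↭ w-perm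
  module U = PermViewProperties (isPerm⇒view u-perm)
  fixes : ∀ i → 1 ≤ i → i ≤ n → at u i ≡ i
  fixes (suc q) _ q<n = trans (at-suc u q) (trans (nth-sortWindow-inside q q<n) (cong (λ k → suc (k + q)) (n∸n≡0 n)))

∃-width : ∀ {α i₁} → α < i₁ → ∃[ b ] (α + suc b ≡ i₁)
∃-width {α} α<i₁ with m≤n⇒∃[o]m+o≡n α<i₁
... | b , e = b , trans (+-suc α b) e

sortOutcome : ∀ {n w h α i₁} → IsPerm n w → Primary n w h α i₁ → SortOutcome n w h α i₁
sortOutcome {n} {w} w-perm (inj₁ (dominant , refl , refl , refl)) = sortOutcome-dominant n w w-perm dominant
sortOutcome w-perm (inj₂ N) with ∃-width (NonDominantProperties.α<i₁ (isPerm⇒view w-perm) N)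
... | b , refl = record
  { perm = u-perm ; primary = sortWindow-primary ; sorted = sortWindow-sorted ; fixes-sorted = sorted⇒sortWindow≡ }
  where open SortStep w-perm N

CycleOutcome : ℕ → List ℕ → ℕ → ℕ → ℕ → Set
CycleOutcome n w h α c = IsPerm n (sDesc α c w) ×
  (∀ h′ α′ i₁′ → Primary n (sDesc α c w) h′ α′ i₁′ → h * suc n + α < h′ * suc n + α′)

cycleOutcome : ∀ {n w h α i₁} → IsPerm n w → Primary n w h α i₁ → w ≢ idPerm n → Sorted w h α i₁ →
  CycleOutcome n w h α (i₁ ∸ α)
cycleOutcome w-perm (inj₁ (_ , refl , refl , refl)) w≢id w-sorted = ⊥-elim (w≢id (sortedDominant⇒idPerm w-perm w-sorted))
cycleOutcome {n} {w} {h} {α} w-perm (inj₂ N) _ w-sorted with ∃-width (NonDominantProperties.α<i₁ (isPerm⇒view w-perm) N)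
... | b , refl = subst (CycleOutcome n w h α) (sym (m+n∸m≡n α (suc b))) (u-perm , sDesc-primary-increases)
  where open CycleStep w-perm N w-sorted

-- The rank

Sorted? : ∀ w h α i₁ → Dec (Sorted w h α i₁)
Sorted? w h α i₁ =
  map′ (λ all → λ { (suc q) _ q<β → all q<β }) (λ sorted {q} q<β → sorted (suc q) (s≤s z≤n) q<β)
       (allUpTo? (λ q → at w (α + suc q) ∸ (h ∸ (i₁ ∸ α)) ≟ suc q) (i₁ ∸ α))

indicator : ∀ {A : Set} → Dec A → ℕ
indicator (yes _) = 1
indicator (no _)  = 0

indicator≤1 : ∀ {A : Set} (a? : Dec A) → indicator a? ≤ 1
indicator≤1 (yes _) = ≤-refl
indicator≤1 (no _)  = z≤n

-- 2 (h (n+1) + α) + [sorted] orders the primary data lexicographically by (h, α, sorted?).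
abstract
  rank : ℕ → List ℕ → ℕ
  rank n w with primary-exists n w
  ... | h , α , i₁ , _ = 2 * (h * suc n + α) + indicator (Sorted? w h α i₁)

  rank≡ : ∀ {n w h α i₁} → Primary n w h α i₁ → rank n w ≡ 2 * (h * suc n + α) + indicator (Sorted? w h α i₁)
  rank≡ {n} {w} primary with primary-exists n w
  ... | _ , _ , _ , primary′ with primary-unique {n} {w} primary′ primary
  ...   | refl , refl , refl = refl

double+indicator-< : ∀ k k′ b b′ → b ≤ 1 → k < k′ → 2 * k + b < 2 * k′ + b′
double+indicator-< k k′ b b′ b≤1 k<k′ = begin-strict
  2 * k + b      ≤⟨ +-monoʳ-≤ (2 * k) b≤1 ⟩
  2 * k + 1      <⟨ +-monoʳ-< (2 * k) (n<1+n 1) ⟩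
  2 * k + 2      ≡⟨ +-comm (2 * k) 2 ⟩
  2 + 2 * k      ≡⟨ *-suc 2 k ⟨
  2 * suc k      ≤⟨ *-monoʳ-≤ 2 k<k′ ⟩
  2 * k′         ≤⟨ m≤m+n (2 * k′) b′ ⟩
  2 * k′ + b′    ∎
  where open ≤-Reasoning

indicator-< : ∀ {A B : Set} (a? : Dec A) (b? : Dec B) → ¬ A → B → indicator a? < indicator b?
indicator-< (yes a) _       ¬a _ = ⊥-elim (¬a a)
indicator-< (no _)  (yes _) _  _ = s≤s z≤n
indicator-< (no _)  (no ¬b) _  b = ⊥-elim (¬b b)

sortStep-rank : ∀ {n w h α i₁} → IsPerm n w → Primary n w h α i₁ → ¬ Sorted w h α i₁ →
  rank n w < rank n (sortWindow α i₁ w)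
sortStep-rank {w = w} {h} {α} {i₁} w-perm primary ¬w-sorted =
  subst₂ _<_ (sym (rank≡ primary)) (sym (rank≡ (SortOutcome.primary outcome)))
    (+-monoʳ-< _ (indicator-< (Sorted? w h α i₁) (Sorted? _ h α i₁) ¬w-sorted (SortOutcome.sorted outcome)))
  where
  outcome : SortOutcome _ w h α i₁
  outcome = sortOutcome w-perm primary

cycleStep-rank : ∀ {n w h α i₁} → IsPerm n w → Primary n w h α i₁ → w ≢ idPerm n → Sorted w h α i₁ →
  rank n w < rank n (sDesc α (i₁ ∸ α) w)
cycleStep-rank {n} {w} {h} {α} {i₁} w-perm primary w≢id w-sorted
  with cycleOutcome w-perm primary w≢id w-sorted | primary-exists n (sDesc α (i₁ ∸ α) w)
... | _ , increases | h′ , α′ , i₁′ , primary′ = subst₂ _<_ (sym (rank≡ primary)) (sym (rank≡ primary′))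
    (double+indicator-< _ _ _ _ (indicator≤1 (Sorted? w h α i₁)) (increases h′ α′ i₁′ primary′))

step-rank : ∀ {n u w} → Step n u w → u ≡ w ⊎ rank n w < rank n u
step-rank (sortStep {w} {h} {α} {i₁} w-perm primary) with Sorted? w h α i₁
... | yes w-sorted = inj₁ (SortOutcome.fixes-sorted (sortOutcome w-perm primary) w-sorted)
... | no ¬w-sorted = inj₂ (sortStep-rank w-perm primary ¬w-sorted)
step-rank (cycleStep w-perm primary w≢id w-sorted) = inj₂ (cycleStep-rank w-perm primary w≢id w-sorted)

≤os-rank : ∀ {n u v} → u ≤os[ n ] v → u ≡ v ⊎ rank n v < rank n u
≤os-rank ε = inj₁ refl
≤os-rank (step ◅ steps) with step-rank step | ≤os-rank steps
... | inj₁ refl | inj₁ refl = inj₁ refl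
... | inj₁ refl | inj₂ lt   = inj₂ lt
... | inj₂ lt   | inj₁ refl = inj₂ lt
... | inj₂ lt   | inj₂ lt′  = inj₂ (<-trans lt′ lt)

≤os-antisym : ∀ {n u v} → u ≤os[ n ] v → v ≤os[ n ] u → u ≡ v
≤os-antisym u≤v v≤u with ≤os-rank u≤v | ≤os-rank v≤u
... | inj₁ u≡v | _        = u≡v
... | inj₂ _   | inj₁ v≡u = sym v≡u
... | inj₂ lt  | inj₂ lt′ = ⊥-elim (<-asym lt lt′)

step-below : ∀ {n w} → IsPerm n w → w ≢ idPerm n → ∃[ u ] (IsPerm n u × Step n u w × rank n w < rank n u)
step-below {n} {w} w-perm w≢id with primary-exists n w
... | h , α , i₁ , primary with Sorted? w h α i₁
...   | no ¬w-sorted = _ , SortOutcome.perm (sortOutcome w-perm primary) , sortStep w-perm primary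
                         , sortStep-rank w-perm primary ¬w-sorted
...   | yes w-sorted = _ , proj₁ (cycleOutcome w-perm primary w≢id w-sorted) , cycleStep w-perm primary w≢id w-sorted
                         , cycleStep-rank w-perm primary w≢id w-sorted

rank-max : ℕ → ℕ
rank-max n = 2 * (n * suc n + n) + 1

rank≤rank-max : ∀ {n w} → IsPerm n w → rank n w ≤ rank-max n
rank≤rank-max {n} {w} w-perm with primary-exists n w
... | h , α , i₁ , primary = ≤-trans (≤-reflexive (rank≡ primary))
  (+-mono-≤ (*-monoʳ-≤ 2 (+-mono-≤ (*-monoˡ-≤ (suc n) (h≤n primary)) (α≤n primary))) (indicator≤1 (Sorted? w h α i₁)))
  where
  h≤n : Primary n w h α i₁ → h ≤ n
  h≤n (inj₁ (_ , refl , _)) = ≤-refl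
  h≤n (inj₂ N)              = <⇒≤ (proj₁ N)
  α≤n : Primary n w h α i₁ → α ≤ n
  α≤n (inj₁ (_ , _ , refl , _)) = z≤n
  α≤n (inj₂ N) = <⇒≤ (<-trans α<i₁ (<-trans (n<1+n i₁) i₁+1<n))
    where open NonDominantProperties (isPerm⇒view w-perm) N

-- Induction on the distance rank-max n ∸ rank n w, which every step below w decreases.
idPerm-≤os : ∀ n w → IsPerm n w → idPerm n ≤os[ n ] w
idPerm-≤os n w w-perm = descend (suc (rank-max n ∸ rank n w)) w w-perm ≤-refl
  where
  descend : ∀ k v → IsPerm n v → rank-max n ∸ rank n v < k → idPerm n ≤os[ n ] v
  descend (suc k) v v-perm gap<k with ≡-dec _≟_ v (idPerm n)
  ... | yes refl = ε
  ... | no v≢id with step-below v-perm v≢id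
  ...   | u , u-perm , u≼v , rank-v<rank-u =
    descend k u u-perm (<-≤-trans (∸-monoʳ-< rank-v<rank-u (rank≤rank-max u-perm)) (≤-pred gap<k)) ◅◅ (u≼v ◅ ε)

proposition5p6 : (n : ℕ) →
    ((u : List ℕ) → IsPerm n u → u ≤os[ n ] u)
  × ((u v x : List ℕ) → IsPerm n u → IsPerm n v → IsPerm n x →
       u ≤os[ n ] v → v ≤os[ n ] x → u ≤os[ n ] x)
  × ((u v : List ℕ) → IsPerm n u → IsPerm n v →
       u ≤os[ n ] v → v ≤os[ n ] u → u ≡ v)
  × ((w : List ℕ) → IsPerm n w → idPerm n ≤os[ n ] w)
proposition5p6 n =
    (λ _ _ → ε)
  , (λ _ _ _ _ _ _ → _◅◅_)
  , (λ _ _ _ _ → ≤os-antisym)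
  , idPerm-≤os n
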